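{- Let $H$ be a digraph, $r\in V(H)$ a vertex from which every vertex of $H$ is reachable, and let $(\hat T,\{B_x\}_{x\in\hat T})$ be the $r$-rooted cut decomposition of $H$. For every vertex $u\in V(H)$ and every set $X\subseteq V(H)\setminus(V(\hat T)\cup\{u\})$ there exists a directed path $P$ from $r$ to $u$ in $H$ with $|V(P)\cap X|\le |X|/2$.
   Context: A vertex $v$ is bi-reachable from $r$ if there exist two internally vertex-disjoint directed paths from $r$ to $v$. For a digraph $H$ with at least two vertices and $r\in V(H)$ from which every vertex is reachable, the diblock $B_r$ of $r$ in $H$ is the set of vertices bi-reachable from $r$ together with $r$ and all out-neighbours of $r$. For $x\in B_r\setminus\{r\}$ let $X_x$ be the set of vertices $v\in V(H)\setminus B_r$ such that every directed path from $r$ to $v$ intersects $B_r$ for the last time in $x$; $x$ is a bottleneck of $B_r$ if $X_x\neq\emptyset$, and $L$ denotes the set of bottlenecks. The $r$-rooted cut decomposition of $H$ is the pair $(\hat T,\{B_x\}_{x\in\hat T})$ defined recursively: $B_r$ is the diblock of $r$ in $H$; for each $x\in L$ let $(\hat T_x,\mathcal B_x)$ be the $x$-rooted cut decomposition of $H[X_x\cup\{x\}]$; $\hat T$ is the rooted tree (whose nodes $V(\hat T)$ are vertices of $H$) with root $r$, set of children of $r$ equal to $L$, and subtree rooted at each $x\in L$ equal to $\hat T_x$; and the collection of diblocks is $\{B_r\}\cup\bigcup_{x\in L}\mathcal B_x$. -}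

module Defs where

open import Data.Nat using (ℕ)
open import Data.Fin using (Fin)
open import Data.Fin.Subset as Sub using (Subset; ⁅_⁆; _∪_)
open import Data.Bool using (Bool; true)
open import Data.Unit using (⊤)
open import Data.List using (List; []; _∷_; _++_)
open import Data.List.Membership.Propositional renaming (_∈_ to _∈ₗ_)
open import Data.List.Relation.Unary.Unique.Propositional using (Unique)
open import Data.List.Relation.Unary.All using (All)
open import Data.Product using (_×_; ∃; ∃₂)
open import Data.Sum using (_⊎_)
open import Relation.Nullary using (¬_)
open import Relation.Binary.PropositionalEquality using (_≡_; _≢_)

Digraph : ℕ → Set
Digraph n = Fin n → Fin n → Bool

-- Vertex sets used to form induced subdigraphs H[S].
VSet : ℕ → Set₁
VSet n = Fin n → Set

Full : ∀ {n} → VSet n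
Full _ = ⊤

vertexSet : ∀ {n} → List (Fin n) → Subset n
vertexSet []       = Sub.⊥
vertexSet (v ∷ vs) = ⁅ v ⁆ ∪ vertexSet vs

module _ {n : ℕ} (H : Digraph n) where

  Arc : Fin n → Fin n → Set
  Arc a b = H a b ≡ true

  -- Walk S a b vs : vs is the vertex sequence of a directed walk from a to b in H[S].
  data Walk (S : VSet n) : Fin n → Fin n → List (Fin n) → Set where
    stop : ∀ {a} → S a → Walk S a a (a ∷ [])
    step : ∀ {a b c vs} → S a → Arc a b → Walk S b c vs → Walk S a c (a ∷ vs)

  IsPath : VSet n → Fin n → Fin n → List (Fin n) → Set
  IsPath S a b vs = Walk S a b vs × Unique vs

  Reachable : VSet n → Fin n → Fin n → Set
  Reachable S a b = ∃ λ vs → IsPath S a b vs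

  BiReachable : VSet n → Fin n → Fin n → Set
  BiReachable S r v = ∃₂ λ ps qs → IsPath S r v ps × IsPath S r v qs
    × (∀ w → w ∈ₗ ps → w ∈ₗ qs → w ≡ r ⊎ w ≡ v)

  Diblock : VSet n → Fin n → Fin n → Set
  Diblock S r w = S w × (w ≡ r ⊎ Arc r w ⊎ BiReachable S r w)

  LastIn : (Fin n → Set) → Fin n → List (Fin n) → Set
  LastIn B x vs = ∃₂ λ pre post → vs ≡ pre ++ (x ∷ post) × All (λ w → ¬ B w) post

  XSet : VSet n → Fin n → Fin n → Fin n → Set
  XSet S r x v = S v × ¬ Diblock S r v
    × (∀ ps → IsPath S r v ps → LastIn (Diblock S r) x ps)

  Bottleneck : VSet n → Fin n → Fin n → Set
  Bottleneck S r x = Diblock S r x × x ≢ r × ∃ (XSet S r x)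

  SubSet : VSet n → Fin n → Fin n → VSet n
  SubSet S r x v = XSet S r x v ⊎ v ≡ x

  -- TreeNode S r y : y is a node of the tree T̂ of the r-rooted cut decomposition of H[S]
  data TreeNode : VSet n → Fin n → Fin n → Set₁ where
    root  : ∀ {S r} → TreeNode S r r
    below : ∀ {S r x y} → Bottleneck S r x → TreeNode (SubSet S r x) x y → TreeNode S r y

-- A vertex other than r and u that lies on every r–u path is a node of T̂. Indeed, on an r–u
-- path the first such vertex d₁ is bi-reachable from r (a vertex separating r from d₁ would be an
-- earlier one separating r from u), so d₁ is a bottleneck with u ∈ X_{d₁}; every later such
-- vertex separates d₁ from u inside H[X_{d₁} ∪ {d₁}], and induction on the path length applies.
-- Hence no vertex of X separates r from u, and the two-path case of Menger's theorem, relative to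
-- the vertex set X, gives two r–u paths without common vertices in X; one of them meets X in at
-- most |X|/2 vertices. The argument is classical, which is harmless since the existence of such a
-- path is decidable.

module Submission where

open import Defs
open import Data.Bool using (true)
import Data.Bool.Properties as Bool
open import Data.Empty using (⊥; ⊥-elim)
open import Data.Fin using (Fin; zero; suc) renaming (_≟_ to _≟ᶠ_)
open import Data.Fin.Properties using (any?)
open import Data.Fin.Subset using (Subset; _∈_; _∩_; ∣_∣; ⁅_⁆; _∪_; inside; outside)
open import Data.Fin.Subset.Properties using (x∈p∪q⁻; x∈⁅y⁆⇒x≡y; ∪-identityˡ; ∣p∣≤n; ∉⊥; ∣⊥∣≡0)
open import Data.List using (List; []; _∷_; _++_; [_]; length; drop)
open import Data.List.Membership.Propositional using () renaming (_∈_ to _∈ₗ_; _∉_ to _∉ₗ_)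
open import Data.List.Membership.Propositional.Properties using (∈-++⁺ˡ; ∈-++⁺ʳ; ∈-++⁻; ∈-∃++)
open import Data.List.Properties using (∷-injectiveˡ; ++-assoc; length-++-≤ʳ)
open import Data.List.Relation.Unary.All as All using (All; []; _∷_)
open import Data.List.Relation.Unary.All.Properties using (¬Any⇒All¬; ++⁺; ++⁻ˡ; ++⁻ʳ)
open import Data.List.Relation.Unary.AllPairs using ([]; _∷_)
open import Data.List.Relation.Unary.Any using (here; there)
open import Data.List.Relation.Unary.Unique.Propositional using (Unique)
open import Data.List.Relation.Unary.Unique.Propositional.Properties using (Unique[x∷xs]⇒x∉xs)
open import Data.Nat using (ℕ; zero; suc; pred; _*_; _+_; _≤_; _<_; z≤n; s≤s; _≤?_; _<?_)
open import Data.Nat.Properties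
open import Data.Product using (_×_; ∃; ∃₂; _,_; proj₁; proj₂)
open import Data.Sum as Sum using (_⊎_; inj₁; inj₂)
open import Data.Unit using (tt)
import Data.Vec as Vec
open import Data.Vec using ([]; _∷_)
open import Function using (_∘_)
open import Level using (Level)
open import Relation.Binary using (tri<; tri≈; tri>)
open import Relation.Binary.PropositionalEquality using (_≡_; _≢_; refl; sym; trans; cong; subst)
open import Relation.Nullary using (¬_; Dec; yes; no)
open import Relation.Nullary.Decidable using (_×-dec_; decidable-stable; ¬¬-excluded-middle)

private
  variable
    ℓ ℓ′ : Level
    A : Set ℓ
    B : Set ℓ′
    x y z : A
    xs : List A
    i j : ℕ

infixl 1 _>>=_

return : A → ¬ ¬ A
return x ¬x = ¬x x

_>>=_ : ¬ ¬ A → (A → ¬ ¬ B) → ¬ ¬ B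
(¬¬x >>= f) ¬y = ¬¬x λ x → f x ¬y

¬¬-first : (P : A → Set) (xs : List A) {x : A} → x ∈ₗ xs → P x
         → ¬ ¬ (∃ λ pre → ∃ λ y → ∃ λ post → xs ≡ pre ++ y ∷ post × P y × All (λ z → ¬ P z) pre)
¬¬-first P (y ∷ xs) (here refl) py = return ([] , y , xs , refl , py , [])
¬¬-first P (y ∷ xs) (there x∈xs) px = do
  no ¬py ← ¬¬-excluded-middle
    where yes py → return ([] , y , xs , refl , py , [])
  (pre , z , post , refl , pz , ¬P-pre) ← ¬¬-first P xs x∈xs px
  return (y ∷ pre , z , post , refl , pz , ¬py ∷ ¬P-pre)

¬¬-maximum : (P : ℕ → Set) (k : ℕ) → (∀ i → P i → i ≤ k)
           → ¬ ¬ ((∀ i → ¬ P i) ⊎ ∃ λ i → P i × ∀ j → P j → j ≤ i)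
¬¬-maximum P zero bounded = do
  no ¬p0 ← ¬¬-excluded-middle
    where yes p0 → return (inj₂ (0 , p0 , bounded))
  return (inj₁ λ i pi → ¬p0 (subst P (n≤0⇒n≡0 (bounded i pi)) pi))
¬¬-maximum P (suc k) bounded = do
  no ¬pk ← ¬¬-excluded-middle
    where yes pk → return (inj₂ (suc k , pk , bounded))
  ¬¬-maximum P k λ i pi → ≤-pred (≤∧≢⇒< (bounded i pi) λ { refl → ¬pk pi })

module _ {A : Set} where

  Unique-++⁻ʳ : ∀ xs {ys : List A} → Unique (xs ++ ys) → Unique ys
  Unique-++⁻ʳ []       u       = u
  Unique-++⁻ʳ (x ∷ xs) (_ ∷ u) = Unique-++⁻ʳ xs u

  Unique-++⇒disjoint : ∀ xs {ys} {x : A} → Unique (xs ++ ys) → x ∈ₗ xs → x ∉ₗ ys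
  Unique-++⇒disjoint (y ∷ xs) u       (here refl)  x∈ys = Unique[x∷xs]⇒x∉xs u (∈-++⁺ʳ xs x∈ys)
  Unique-++⇒disjoint (y ∷ xs) (_ ∷ u) (there x∈xs)      = Unique-++⇒disjoint xs u x∈xs

  Unique-++∷⇒Unique-++[] : ∀ xs {x : A} {ys} → Unique (xs ++ x ∷ ys) → Unique (xs ++ [ x ])
  Unique-++∷⇒Unique-++[] []       _         = [] ∷ []
  Unique-++∷⇒Unique-++[] (y ∷ xs) (y∉ ∷ u) =
    ++⁺ (++⁻ˡ xs y∉) (All.head (++⁻ʳ xs y∉) ∷ []) ∷ Unique-++∷⇒Unique-++[] xs u

infix 4 _[_]=_

data _[_]=_ {A : Set ℓ} : List A → ℕ → A → Set ℓ where
  top : ∀ {x xs} → x ∷ xs [ 0 ]= x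
  pop : ∀ {x y xs i} → xs [ i ]= y → x ∷ xs [ suc i ]= y

[]=⇒∈ : xs [ i ]= y → y ∈ₗ xs
[]=⇒∈ top     = here refl
[]=⇒∈ (pop p) = there ([]=⇒∈ p)

∈⇒[]= : y ∈ₗ xs → ∃ λ i → xs [ i ]= y
∈⇒[]= (here refl) = 0 , top
∈⇒[]= (there y∈)  = let i , p = ∈⇒[]= y∈ in suc i , pop p

[]=-functional : xs [ i ]= y → xs [ i ]= z → y ≡ z
[]=-functional top     top     = refl
[]=-functional (pop p) (pop q) = []=-functional p q

[]=-injective : Unique xs → xs [ i ]= y → xs [ j ]= y → i ≡ j
[]=-injective u       top     top     = refl
[]=-injective u       top     (pop q) = ⊥-elim (Unique[x∷xs]⇒x∉xs u ([]=⇒∈ q))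
[]=-injective u       (pop p) top     = ⊥-elim (Unique[x∷xs]⇒x∉xs u ([]=⇒∈ p))
[]=-injective (_ ∷ u) (pop p) (pop q) = cong suc ([]=-injective u p q)

[]=⇒<length : xs [ i ]= y → i < length xs
[]=⇒<length top     = s≤s z≤n
[]=⇒<length (pop p) = s≤s ([]=⇒<length p)

<length⇒[]= : (xs : List A) {i : ℕ} → i < length xs → ∃ λ y → xs [ i ]= y
<length⇒[]= (x ∷ xs) {zero}  _       = x , top
<length⇒[]= (x ∷ xs) {suc i} (s≤s p) = let y , q = <length⇒[]= xs p in y , pop q

-- Walks and paths

module Walks {n : ℕ} (H : Digraph n) where

  open import Data.List.Membership.DecPropositional (_≟ᶠ_ {n}) public using () renaming (_∈?_ to _∈ₗ?_)

  private
    variable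
      S S′ : VSet n
      s t v w : Fin n
      vs ws : List (Fin n)

  walk-head : Walk H S s t vs → vs ≡ s ∷ drop 1 vs
  walk-head (stop _)     = refl
  walk-head (step _ _ _) = refl

  source∈walk : Walk H S s t vs → s ∈ₗ vs
  source∈walk W = subst (_ ∈ₗ_) (sym (walk-head W)) (here refl)

  target∈walk : Walk H S s t vs → t ∈ₗ vs
  target∈walk (stop _)     = here refl
  target∈walk (step _ _ W) = there (target∈walk W)

  walk-⊆ : Walk H S s t vs → w ∈ₗ vs → S w
  walk-⊆ (stop Ss)     (here refl) = Ss
  walk-⊆ (step Ss _ _) (here refl) = Ss
  walk-⊆ (step _ _ W)  (there w∈)  = walk-⊆ W w∈

  source∈S : Walk H S s t vs → S s
  source∈S W = walk-⊆ W (source∈walk W)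

  target∈S : Walk H S s t vs → S t
  target∈S W = walk-⊆ W (target∈walk W)

  walk-restrict : Walk H S s t vs → (∀ w → w ∈ₗ vs → S′ w) → Walk H S′ s t vs
  walk-restrict (stop _)      S′vs = stop (S′vs _ (here refl))
  walk-restrict (step _ arc W) S′vs = step (S′vs _ (here refl)) arc (walk-restrict W (λ w → S′vs w ∘ there))

  infixr 5 _++ʷ_

  _++ʷ_ : Walk H S s t vs → Walk H S t v ws → Walk H S s v (vs ++ drop 1 ws)
  stop _      ++ʷ W′ = subst (Walk H _ _ _) (walk-head W′) W′
  step Ss arc W ++ʷ W′ = step Ss arc (W ++ʷ W′)

  ∈-++ʷ⁻ : ∀ vs ws → w ∈ₗ vs ++ drop 1 ws → w ∈ₗ vs ⊎ w ∈ₗ ws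
  ∈-++ʷ⁻ vs ws w∈ with ∈-++⁻ vs w∈
  ∈-++ʷ⁻ vs ws       w∈ | inj₁ w∈vs = inj₁ w∈vs
  ∈-++ʷ⁻ vs (_ ∷ ws) w∈ | inj₂ w∈ws = inj₂ (there w∈ws)

  walk-split : ∀ pre {x} post → Walk H S s t (pre ++ x ∷ post)
             → Walk H S s x (pre ++ [ x ]) × Walk H S x t (x ∷ post)
  walk-split []            post (stop Ss)      = stop Ss , stop Ss
  walk-split []            post (step Ss arc W)  = stop Ss , step Ss arc W
  walk-split (_ ∷ [])      post (step Ss arc W)  with refl ← walk-head W = step Ss arc (stop (source∈S W)) , W
  walk-split (_ ∷ y ∷ pre) post (step Ss arc W)  =
    let W₁ , W₂ = walk-split (y ∷ pre) post W in step Ss arc W₁ , W₂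

  PathWithin : VSet n → Fin n → Fin n → List (Fin n) → Set
  PathWithin S s t vs = ∃ λ ps → IsPath H S s t ps × (∀ w → w ∈ₗ ps → w ∈ₗ vs)

  walk⇒path : Walk H S s t vs → PathWithin S s t vs
  walk⇒path (stop Ss)     = _ , (stop Ss , [] ∷ []) , λ _ w∈ → w∈
  walk⇒path {s = s} (step Ss arc W) with walk⇒path W
  ... | ps , (Wp , up) , ps⊆ with s ∈ₗ? ps
  ...   | no s∉ps =
    s ∷ ps , (step Ss arc Wp , ¬Any⇒All¬ ps s∉ps ∷ up) , λ { w (here e) → here e ; w (there w∈) → there (ps⊆ w w∈) }
  ...   | yes s∈ps with pre , post , refl ← ∈-∃++ s∈ps =
    s ∷ post , (proj₂ (walk-split pre post Wp) , Unique-++⁻ʳ pre up) , λ w w∈ → there (ps⊆ w (∈-++⁺ʳ pre w∈))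

  target∈tail : Walk H S s t (s ∷ vs) → y ∈ₗ vs → t ∈ₗ vs
  target∈tail (step _ _ W) _ = target∈walk W

  step⁻ : Walk H S s t (s ∷ v ∷ vs) → Arc H s v × Walk H S v t (v ∷ vs)
  step⁻ (step _ arc W) with refl ← walk-head W = arc , W

  walk-target-at-last : Walk H S s t vs → vs [ pred (length vs) ]= t
  walk-target-at-last (stop _)                = top
  walk-target-at-last (step _ _ (stop _))     = pop top
  walk-target-at-last (step _ _ W@(step _ _ _)) = pop (walk-target-at-last W)

  walk-source-at-0 : Walk H S s t vs → vs [ 0 ]= s
  walk-source-at-0 (stop _)     = top
  walk-source-at-0 (step _ _ _) = top

  walk-arc : Walk H S s t vs → vs [ i ]= v → vs [ suc i ]= w → Arc H v w
  walk-arc (step _ arc (stop _))     top     (pop top) = arc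
  walk-arc (step _ arc (step _ _ _)) top     (pop top) = arc
  walk-arc (step _ _ W)              (pop p) (pop q)   = walk-arc W p q

  Between : List (Fin n) → ℕ → ℕ → Fin n → Set
  Between vs i j w = ∃ λ k → i ≤ k × k ≤ j × vs [ k ]= w

  walk-segment : Walk H S s t vs → vs [ i ]= v → vs [ j ]= w → i ≤ j
               → ∃ λ ws → Walk H S v w ws × (∀ z → z ∈ₗ ws → Between vs i j z)
  walk-segment (stop Ss)     top     top     _         = _ , stop Ss , λ { _ (here refl) → 0 , z≤n , z≤n , top }
  walk-segment (step Ss _ _) top     top     _         = _ , stop Ss , λ { _ (here refl) → 0 , z≤n , z≤n , top }
  walk-segment (step Ss arc W) top     (pop q) _         =
    let ws , Wws , ws⊆ = walk-segment W (walk-source-at-0 W) q z≤n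
    in _ , step Ss arc Wws , λ { _ (here refl) → 0 , z≤n , z≤n , top
                             ; z (there z∈) → let k , _ , k≤j , p = ws⊆ z z∈ in suc k , z≤n , s≤s k≤j , pop p }
  walk-segment (step _ _ W)  (pop p) (pop q) (s≤s i≤j) =
    let ws , Wws , ws⊆ = walk-segment W p q i≤j
    in ws , Wws , λ z z∈ → let k , i≤k , k≤j , r = ws⊆ z z∈ in suc k , s≤s i≤k , s≤s k≤j , pop r

  suffix-avoids : ∀ pre {post} → Walk H S s t (pre ++ x ∷ post) → Unique (pre ++ x ∷ post) → y ∈ₗ post
                → ∃ λ vs → Walk H S y t vs × x ∉ₗ vs
  suffix-avoids {x = x} pre W U y∈ with p₁ , p₂ , refl ← ∈-∃++ y∈ =
    _ , proj₂ (walk-split (pre ++ x ∷ p₁) p₂ (subst (Walk H _ _ _) reassoc W)) ,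
    Unique-++⇒disjoint (pre ++ x ∷ p₁) (subst Unique reassoc U) (∈-++⁺ʳ pre (here refl))
    where
    reassoc = sym (++-assoc pre (x ∷ p₁) _)

  suffix-shorter : ∀ pre {post} → Walk H S s t (pre ++ x ∷ post) → x ≢ s
                 → length (x ∷ post) < length (pre ++ x ∷ post)
  suffix-shorter []        W x≢s = ⊥-elim (x≢s (∷-injectiveˡ (walk-head W)))
  suffix-shorter (_ ∷ pre) {post} _ _ = s≤s (length-++-≤ʳ (_ ∷ post) {pre})

  Separates : VSet n → Fin n → Fin n → Fin n → Set
  Separates S s t x = x ≢ s × (∀ qs → IsPath H S s t qs → x ∈ₗ qs)

  separates-walk : Separates S s t x → Walk H S s t vs → x ∈ₗ vs
  separates-walk (_ , on-paths) W = let ps , P , ps⊆ = walk⇒path W in ps⊆ _ (on-paths ps P)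

  ¬separates⇒¬¬avoidable : x ≢ s → ¬ Separates S s t x → ¬ ¬ ∃ λ qs → Walk H S s t qs × x ∉ₗ qs
  ¬separates⇒¬¬avoidable x≢s ¬sep ¬avoidable =
    ¬sep (x≢s , λ qs (Wq , _) → decidable-stable (_ ∈ₗ? qs) λ x∉ → ¬avoidable (qs , Wq , x∉))

-- Menger's theorem for two paths, relative to a vertex set X

-- Along a fixed r–u path ps, a bypass from position a to position b is a path between these
-- vertices of ps avoiding X ∩ V(ps) in its interior. Two X-disjoint walks from r leapfrog along
-- ps, one of them being extended through a bypass to the farthest position available.
module TwoPaths {n : ℕ} (H : Digraph n) (S : VSet n) (X : Fin n → Set) {r u : Fin n} {ps : List (Fin n)}
  (Wp : Walk H S r u ps) (up : Unique ps) (r∉X : ¬ X r) (u∉X : ¬ X u)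
  (non-separating : ∀ x → X x → ¬ Walks.Separates H S r u x) where

  open Walks H

  avoidable : ∀ x → X x → ¬ ¬ ∃ λ qs → Walk H S r u qs × x ∉ₗ qs
  avoidable x Xx = ¬separates⇒¬¬avoidable (λ { refl → r∉X Xx }) (non-separating x Xx)

  private
    variable
      a a′ b k α β : ℕ
      v w : Fin n
      vs : List (Fin n)

  m : ℕ
  m = pred (length ps)

  u-at-m : ps [ m ]= u
  u-at-m = walk-target-at-last Wp

  r-at-0 : ps [ 0 ]= r
  r-at-0 = walk-source-at-0 Wp

  ≤m : ps [ i ]= v → i ≤ m
  ≤m p = <⇒≤pred ([]=⇒<length p)

  position-unique : ps [ i ]= v → ps [ j ]= v → i ≡ j
  position-unique = []=-injective up

  Clean : Fin n → Fin n → List (Fin n) → Set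
  Clean v z vs = ∀ w → w ∈ₗ vs → w ≡ v ⊎ w ≡ z ⊎ ¬ (X w × w ∈ₗ ps)

  CleanFrom : ℕ → Fin n → Set
  CleanFrom a z = ∃ λ v → ∃ λ vs → ps [ a ]= v × IsPath H S v z vs × Clean v z vs

  Bypass : ℕ → ℕ → Set
  Bypass a b = ∃ λ w → ps [ b ]= w × CleanFrom a w

  BypassesUpTo : ℕ → ℕ → Set
  BypassesUpTo a β = ∀ b → Bypass a b → b ≤ β

  bypass-≤m : Bypass a b → b ≤ m
  bypass-≤m (_ , at-b , _) = ≤m at-b

  cleanFrom-prefix : ps [ a ]= v → IsPath H S v z vs → Clean v z vs → w ∈ₗ vs → CleanFrom a w
  cleanFrom-prefix {v = v} {w = w} at-a (Wv , uv) clean w∈ with pre , post , refl ← ∈-∃++ w∈ =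
    v , pre ++ [ w ] , at-a , (proj₁ (walk-split pre post Wv) , Unique-++∷⇒Unique-++[] pre uv) , clean′
    where
    clean′ : Clean v w (pre ++ [ w ])
    clean′ y y∈ with ∈-++⁻ pre y∈
    ... | inj₂ (here y≡w) = inj₂ (inj₁ y≡w)
    ... | inj₁ y∈pre with clean y (∈-++⁺ˡ y∈pre)
    ...   | inj₁ y≡v         = inj₁ y≡v
    ...   | inj₂ (inj₂ y∉)   = inj₂ (inj₂ y∉)
    ...   | inj₂ (inj₁ refl) =
      ⊥-elim (Unique-++⇒disjoint pre uv y∈pre (target∈walk (proj₂ (walk-split pre post Wv))))

  source∉suffix : ∀ pre {post} → Walk H S v w (pre ++ z ∷ post) → Unique (pre ++ z ∷ post)
                → z ∉ₗ ps → ps [ a ]= v → v ∉ₗ post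
  source∉suffix []        Wv _  z∉ps at-a _ =
    z∉ps (subst (_∈ₗ ps) (sym (∷-injectiveˡ (walk-head Wv))) ([]=⇒∈ at-a))
  source∉suffix (_ ∷ pre) Wv uv _ _ v∈post =
    Unique-++⇒disjoint (_ ∷ pre) uv (here (sym (∷-injectiveˡ (walk-head Wv)))) (there v∈post)

  cleanFrom-++ : CleanFrom a z → z ∉ₗ ps → ps [ a′ ]= v → IsPath H S v w vs → Clean v w vs → z ∈ₗ vs
               → CleanFrom a w
  cleanFrom-++ {z = z} {w = w} (v₀ , qs , at-a , (Wq , _) , clean-q) z∉ps at-a′ (Wv , uv) clean-v z∈
    with pre , post , refl ← ∈-∃++ z∈
    with ws , Pw , ws⊆ ← walk⇒path (Wq ++ʷ proj₂ (walk-split pre post Wv)) =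
    v₀ , ws , at-a , Pw , clean
    where
    clean : Clean v₀ w ws
    clean y y∈ with ∈-++ʷ⁻ qs (z ∷ post) (ws⊆ y y∈)
    ... | inj₁ y∈qs with clean-q y y∈qs
    ...   | inj₁ y≡v₀        = inj₁ y≡v₀
    ...   | inj₂ (inj₁ refl) = inj₂ (inj₂ (z∉ps ∘ proj₂))
    ...   | inj₂ (inj₂ y∉)   = inj₂ (inj₂ y∉)
    clean y y∈ | inj₂ (here refl) = inj₂ (inj₂ (z∉ps ∘ proj₂))
    clean y y∈ | inj₂ (there y∈post) with clean-v y (∈-++⁺ʳ pre (there y∈post))
    ...   | inj₁ refl = ⊥-elim (source∉suffix pre Wv uv z∉ps at-a′ y∈post)
    ...   | inj₂ c    = inj₂ c

  Straddles : ℕ → Set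
  Straddles i = ∃₂ λ a b → a < i × i < b × Bypass a b

  module _ {p : Fin n} (p-at-i : ps [ i ]= p) (i<m : i < m) where

    private
      OffPathFrom : Fin n → List (Fin n) → Set
      OffPathFrom v qs = ∀ w → w ∈ₗ qs → w ≡ v ⊎ w ∉ₗ ps

    -- Follow a walk avoiding p, remembering the last position a < i at which it met ps.
    straddle-search : Walk H S v u vs → p ∉ₗ vs → ∀ {v₀ qs} → ps [ a ]= v₀ → a < i
                    → Walk H S v₀ v qs → OffPathFrom v₀ qs → v ∉ₗ ps ⊎ v ≡ v₀ → Straddles i
    straddle-search (stop _) _ _    _   _ _ (inj₁ u∉ps) = ⊥-elim (u∉ps ([]=⇒∈ u-at-m))
    straddle-search (stop _) _ at-a a<i _ _ (inj₂ refl) =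
      ⊥-elim (<-irrefl refl (<-trans (subst (_< i) (position-unique at-a u-at-m) a<i) i<m))
    straddle-search {v = v} (step {b = w} Sv arc W) p∉ {v₀} {qs} at-a a<i Wq off v-off with w ∈ₗ? ps
    ... | no w∉ps =
      straddle-search W (p∉ ∘ there) at-a a<i (Wq ++ʷ step Sv arc (stop (source∈S W))) off′ (inj₁ w∉ps)
      where
      off′ : OffPathFrom v₀ (qs ++ drop 1 (v ∷ w ∷ []))
      off′ y y∈ with ∈-++ʷ⁻ qs (v ∷ w ∷ []) y∈
      ... | inj₁ y∈qs              = off y y∈qs
      ... | inj₂ (here refl)        = Sum.swap v-off
      ... | inj₂ (there (here refl)) = inj₂ w∉ps
    ... | yes w∈ps with j , at-j ← ∈⇒[]= w∈ps with <-cmp j i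
    ...   | tri≈ _ refl _ = ⊥-elim (p∉ (there (subst (_∈ₗ _) ([]=-functional at-j p-at-i) (source∈walk W))))
    ...   | tri< j<i _ _  =
      straddle-search W (p∉ ∘ there) at-j j<i (stop (source∈S W)) (λ { _ (here e) → inj₁ e }) (inj₂ refl)
    ...   | tri> _ _ i<j  with ws , Pw , ws⊆ ← walk⇒path (Wq ++ʷ step Sv arc (stop (source∈S W))) =
      _ , j , a<i , i<j , w , at-j , v₀ , ws , at-a , Pw , clean
      where
      clean : Clean v₀ w ws
      clean y y∈ with ∈-++ʷ⁻ qs (v ∷ w ∷ []) (ws⊆ y y∈)
      ... | inj₂ (there (here y≡w)) = inj₂ (inj₁ y≡w)
      ... | inj₂ (here refl)        = Sum.[ (λ v∉ → inj₂ (inj₂ (v∉ ∘ proj₂))) , inj₁ ] v-off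
      ... | inj₁ y∈qs               = Sum.[ inj₁ , (λ y∉ → inj₂ (inj₂ (y∉ ∘ proj₂))) ] (off y y∈qs)

    straddle : 0 < i → (∃ λ qs → Walk H S r u qs × p ∉ₗ qs) → Straddles i
    straddle 0<i (_ , Wq , p∉) =
      straddle-search Wq p∉ r-at-0 0<i (stop (source∈S Wp)) (λ { _ (here e) → inj₁ e }) (inj₂ refl)

  Trapped : ℕ → Fin n → Set
  Trapped β w = w ∉ₗ ps × ∃ λ a → CleanFrom a w × BypassesUpTo a β

  trapped-mono : β ≤ k → Trapped β w → Trapped k w
  trapped-mono β≤k (w∉ps , a , cf , upTo) = w∉ps , a , cf , λ b bp → ≤-trans (upTo b bp) β≤k

  OnPathOr : (ℕ → Set) → ℕ → Fin n → Set
  OnPathOr P β w = (∃ λ i → ps [ i ]= w × P i) ⊎ Trapped β w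

  -- Continuing the trail along ps up to β keeps it X-disjoint from the lead, so at β = m the two
  -- walks solve the problem.
  -- Off-path X-vertices are Trapped: reaching them again would give a bypass beyond β.
  record Linkage (α β : ℕ) : Set where
    field
      α≤β        : α ≤ β
      rear front : Fin n
      rear-at    : ps [ α ]= rear
      front-at   : ps [ β ]= front
      lead trail : List (Fin n)
      lead-walk  : Walk H S r front lead
      trail-walk : Walk H S r rear trail
      lead-X     : ∀ w → w ∈ₗ lead → X w → OnPathOr (λ i → i < α ⊎ i ≡ β) β w
      trail-X    : ∀ w → w ∈ₗ trail → X w → OnPathOr (_≤ α) β w
      early      : ∀ a → a < α → BypassesUpTo a β
      X-disjoint : ∀ w → X w → w ∈ₗ lead → w ∈ₗ trail → ⊥

  open Linkage

  lead-X-position : (L : Linkage α β) → X w → w ∈ₗ lead L → ps [ k ]= w → α ≤ k → k ≡ β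
  lead-X-position {α = α} L Xw w∈ at-k α≤k with lead-X L _ w∈ Xw
  ... | inj₁ (i , at-i , inj₁ i<α) = ⊥-elim (<⇒≱ i<α (subst (α ≤_) (position-unique at-k at-i) α≤k))
  ... | inj₁ (i , at-i , inj₂ i≡β) = trans (position-unique at-k at-i) i≡β
  ... | inj₂ (w∉ps , _)            = ⊥-elim (w∉ps ([]=⇒∈ at-k))

  trail-X-position : (L : Linkage α β) → X w → w ∈ₗ trail L → ps [ k ]= w → k ≤ α
  trail-X-position {α = α} L Xw w∈ at-k with trail-X L _ w∈ Xw
  ... | inj₁ (i , at-i , i≤α) = subst (_≤ α) (position-unique at-i at-k) i≤α
  ... | inj₂ (w∉ps , _)       = ⊥-elim (w∉ps ([]=⇒∈ at-k))

  off-path-blocks : ∀ {P} → OnPathOr P β w → ¬ (X w × w ∈ₗ ps) → X w → ps [ a ]= v → ps [ b ]= z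
                  → IsPath H S v z vs → Clean v z vs → w ∈ₗ vs → b ≤ β
  off-path-blocks (inj₁ (_ , at-i , _))        off Xw _    _    _ _     _  = ⊥-elim (off (Xw , []=⇒∈ at-i))
  off-path-blocks (inj₂ (w∉ps , a , cf , upTo)) _  _  at-a at-b P clean w∈ =
    upTo _ (_ , at-b , cleanFrom-++ cf w∉ps at-a P clean w∈)

  bypass-X : ps [ a ]= v → ps [ b ]= z → IsPath H S v z vs → Clean v z vs → BypassesUpTo a b
           → w ∈ₗ vs → X w → w ≡ v ⊎ ps [ b ]= w ⊎ Trapped b w
  bypass-X at-a at-b P clean upTo w∈ Xw with clean _ w∈
  ... | inj₁ w≡v         = inj₁ w≡v
  ... | inj₂ (inj₁ refl) = inj₂ (inj₁ at-b)
  ... | inj₂ (inj₂ off)  = inj₂ (inj₂ (off ∘ (Xw ,_) , _ , cleanFrom-prefix at-a P clean w∈ , upTo))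

  TwoWalks : Set
  TwoWalks = ∃₂ λ as bs → Walk H S r u as × Walk H S r u bs × (∀ w → X w → w ∈ₗ as → w ∈ₗ bs → ⊥)

  linkage-start : Linkage 0 0
  linkage-start = record
    { α≤β = z≤n ; rear = r ; front = r ; rear-at = r-at-0 ; front-at = r-at-0
    ; lead = [ r ] ; trail = [ r ] ; lead-walk = stop (source∈S Wp) ; trail-walk = stop (source∈S Wp)
    ; lead-X     = λ { _ (here refl) Xr → ⊥-elim (r∉X Xr) }
    ; trail-X    = λ { _ (here refl) Xr → ⊥-elim (r∉X Xr) }
    ; early      = λ _ ()
    ; X-disjoint = λ { _ Xr (here refl) _ → r∉X Xr } }

  linkage-complete : Linkage α m → TwoWalks
  linkage-complete L with sg , Wsg , sg⊆ ← walk-segment Wp (rear-at L) (front-at L) (α≤β L)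
                     with refl ← []=-functional (front-at L) u-at-m =
    lead L , trail L ++ drop 1 sg , lead-walk L , trail-walk L ++ʷ Wsg , disjoint
    where
    disjoint : ∀ w → X w → w ∈ₗ lead L → w ∈ₗ trail L ++ drop 1 sg → ⊥
    disjoint w Xw w∈lead w∈ with ∈-++ʷ⁻ (trail L) sg w∈
    ... | inj₁ w∈trail = X-disjoint L w Xw w∈lead w∈trail
    ... | inj₂ w∈sg with k , α≤k , _ , at-k ← sg⊆ w w∈sg
                    with refl ← lead-X-position L Xw w∈lead at-k α≤k =
      u∉X (subst X ([]=-functional at-k u-at-m) Xw)

  Overreach : ℕ → ℕ → ℕ → Set
  Overreach α β b = ∃ λ a → α ≤ a × a < β × Bypass a b × β < b

  bypasses-below : Linkage α β → (∀ b → Overreach α β b → b ≤ k) → β ≤ k → ∀ a → a < β → BypassesUpTo a k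
  bypasses-below {α = α} {β = β} L maximal β≤k a a<β b bp with a <? α | b ≤? β
  ... | yes a<α | _       = ≤-trans (early L a a<α b bp) β≤k
  ... | no _    | yes b≤β = ≤-trans b≤β β≤k
  ... | no a≮α  | no b≰β  = maximal b (a , ≮⇒≥ a≮α , a<β , bp , ≰⇒> b≰β)

  advance-overreach : (L : Linkage α β) → Overreach α β b → (∀ b′ → Overreach α β b′ → b′ ≤ b) → Linkage β b
  advance-overreach {β = β} {b = b} L
    (a′ , α≤a′ , a′<β , (z , at-b , v , vs , at-a′ , P@(Wv , _) , clean) , β<b) maximal
    with sg , Wsg , sg⊆ ← walk-segment Wp (rear-at L) at-a′ α≤a′ = record
    { α≤β = <⇒≤ β<b ; rear = front L ; front = z ; rear-at = front-at L ; front-at = at-b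
    ; lead = (trail L ++ drop 1 sg) ++ drop 1 vs ; trail = lead L
    ; lead-walk = (trail-walk L ++ʷ Wsg) ++ʷ Wv ; trail-walk = lead-walk L
    ; lead-X = new-lead-X ; trail-X = new-trail-X
    ; early = bypasses-below L maximal (<⇒≤ β<b) ; X-disjoint = disjoint }
    where
    new-lead-X : ∀ w → w ∈ₗ (trail L ++ drop 1 sg) ++ drop 1 vs → X w → OnPathOr (λ i → i < β ⊎ i ≡ b) b w
    new-lead-X w w∈ Xw with ∈-++ʷ⁻ (trail L ++ drop 1 sg) vs w∈
    ... | inj₂ w∈vs with bypass-X at-a′ at-b P clean (bypasses-below L maximal (<⇒≤ β<b) a′ a′<β) w∈vs Xw
    ...   | inj₁ refl           = inj₁ (a′ , at-a′ , inj₁ a′<β)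
    ...   | inj₂ (inj₁ at-b′)   = inj₁ (b , at-b′ , inj₂ refl)
    ...   | inj₂ (inj₂ trapped) = inj₂ trapped
    new-lead-X w w∈ Xw | inj₁ w∈ts with ∈-++ʷ⁻ (trail L) sg w∈ts
    ... | inj₂ w∈sg = let k , _ , k≤a′ , at-k = sg⊆ w w∈sg in inj₁ (k , at-k , inj₁ (≤-<-trans k≤a′ a′<β))
    ... | inj₁ w∈trail with trail-X L w w∈trail Xw
    ...   | inj₁ (i , at-i , i≤α) = inj₁ (i , at-i , inj₁ (≤-<-trans i≤α (≤-<-trans α≤a′ a′<β)))
    ...   | inj₂ trapped          = inj₂ (trapped-mono (<⇒≤ β<b) trapped)
    new-trail-X : ∀ w → w ∈ₗ lead L → X w → OnPathOr (_≤ β) b w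
    new-trail-X w w∈ Xw with lead-X L w w∈ Xw
    ... | inj₁ (i , at-i , inj₁ i<α) = inj₁ (i , at-i , ≤-trans (<⇒≤ i<α) (α≤β L))
    ... | inj₁ (i , at-i , inj₂ i≡β) = inj₁ (i , at-i , ≤-reflexive i≡β)
    ... | inj₂ trapped               = inj₂ (trapped-mono (<⇒≤ β<b) trapped)
    disjoint : ∀ w → X w → w ∈ₗ (trail L ++ drop 1 sg) ++ drop 1 vs → w ∈ₗ lead L → ⊥
    disjoint w Xw w∈ w∈lead with ∈-++ʷ⁻ (trail L ++ drop 1 sg) vs w∈
    ... | inj₁ w∈ts with ∈-++ʷ⁻ (trail L) sg w∈ts
    ...   | inj₁ w∈trail = X-disjoint L w Xw w∈lead w∈trail
    ...   | inj₂ w∈sg    = let k , α≤k , k≤a′ , at-k = sg⊆ w w∈sg in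
      <-irrefl (lead-X-position L Xw w∈lead at-k α≤k) (≤-<-trans k≤a′ a′<β)
    disjoint w Xw w∈ w∈lead | inj₂ w∈vs with clean w w∈vs
    ... | inj₁ refl        = <-irrefl (lead-X-position L Xw w∈lead at-a′ α≤a′) a′<β
    ... | inj₂ (inj₁ refl) =
      <-irrefl (sym (lead-X-position L Xw w∈lead at-b (≤-trans (α≤β L) (<⇒≤ β<b)))) β<b
    ... | inj₂ (inj₂ off)  =
      <⇒≱ β<b (off-path-blocks (lead-X L w w∈lead Xw) off Xw at-a′ at-b P clean w∈vs)

  advance-front : (L : Linkage α β) → ¬ X (front L) → (∀ b′ → ¬ Overreach α β b′)
                → Bypass β b → BypassesUpTo β b → β < b → Linkage β b
  advance-front {β = β} {b = b} L front∉X no-overreach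
    (z , at-b , v , vs , at-β , P@(Wv , _) , clean) upTo β<b
    with refl ← []=-functional at-β (front-at L)
    with sg , Wsg , sg⊆ ← walk-segment Wp (rear-at L) (front-at L) (α≤β L) = record
    { α≤β = <⇒≤ β<b ; rear = front L ; front = z ; rear-at = front-at L ; front-at = at-b
    ; lead = lead L ++ drop 1 vs ; trail = trail L ++ drop 1 sg
    ; lead-walk = lead-walk L ++ʷ Wv ; trail-walk = trail-walk L ++ʷ Wsg
    ; lead-X = new-lead-X ; trail-X = new-trail-X
    ; early = bypasses-below L (λ b′ → ⊥-elim ∘ no-overreach b′) (<⇒≤ β<b) ; X-disjoint = disjoint }
    where
    new-lead-X : ∀ w → w ∈ₗ lead L ++ drop 1 vs → X w → OnPathOr (λ i → i < β ⊎ i ≡ b) b w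
    new-lead-X w w∈ Xw with ∈-++ʷ⁻ (lead L) vs w∈
    ... | inj₂ w∈vs with bypass-X at-β at-b P clean upTo w∈vs Xw
    ...   | inj₁ refl           = ⊥-elim (front∉X Xw)
    ...   | inj₂ (inj₁ at-b′)   = inj₁ (b , at-b′ , inj₂ refl)
    ...   | inj₂ (inj₂ trapped) = inj₂ trapped
    new-lead-X w w∈ Xw | inj₁ w∈lead with lead-X L w w∈lead Xw
    ...   | inj₁ (i , at-i , inj₁ i<α) = inj₁ (i , at-i , inj₁ (<-≤-trans i<α (α≤β L)))
    ...   | inj₁ (i , at-i , inj₂ refl) = ⊥-elim (front∉X (subst X ([]=-functional at-i at-β) Xw))
    ...   | inj₂ trapped               = inj₂ (trapped-mono (<⇒≤ β<b) trapped)
    new-trail-X : ∀ w → w ∈ₗ trail L ++ drop 1 sg → X w → OnPathOr (_≤ β) b w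
    new-trail-X w w∈ Xw with ∈-++ʷ⁻ (trail L) sg w∈
    ... | inj₂ w∈sg = let k , _ , k≤β , at-k = sg⊆ w w∈sg in inj₁ (k , at-k , k≤β)
    ... | inj₁ w∈trail with trail-X L w w∈trail Xw
    ...   | inj₁ (i , at-i , i≤α) = inj₁ (i , at-i , ≤-trans i≤α (α≤β L))
    ...   | inj₂ trapped          = inj₂ (trapped-mono (<⇒≤ β<b) trapped)
    disjoint : ∀ w → X w → w ∈ₗ lead L ++ drop 1 vs → w ∈ₗ trail L ++ drop 1 sg → ⊥
    disjoint w Xw w∈ w∈′ with ∈-++ʷ⁻ (lead L) vs w∈ | ∈-++ʷ⁻ (trail L) sg w∈′
    ... | inj₁ w∈lead | inj₁ w∈trail = X-disjoint L w Xw w∈lead w∈trail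
    ... | inj₁ w∈lead | inj₂ w∈sg    with k , α≤k , _ , at-k ← sg⊆ w w∈sg
                                     with refl ← lead-X-position L Xw w∈lead at-k α≤k =
      front∉X (subst X ([]=-functional at-k at-β) Xw)
    ... | inj₂ w∈vs   | w∈trail-or-sg with clean w w∈vs
    ...   | inj₁ refl        = front∉X Xw
    ...   | inj₂ (inj₁ refl) = <⇒≱ β<b (case w∈trail-or-sg)
      where
      case : w ∈ₗ trail L ⊎ w ∈ₗ sg → b ≤ β
      case (inj₁ w∈trail) = ≤-trans (trail-X-position L Xw w∈trail at-b) (α≤β L)
      case (inj₂ w∈sg)    =
        let k , _ , k≤β , at-k = sg⊆ w w∈sg in subst (_≤ β) (position-unique at-k at-b) k≤β
    ...   | inj₂ (inj₂ off)  = case w∈trail-or-sg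
      where
      case : w ∈ₗ trail L ⊎ w ∈ₗ sg → ⊥
      case (inj₁ w∈trail) = <⇒≱ β<b (off-path-blocks (trail-X L w w∈trail Xw) off Xw at-β at-b P clean w∈vs)
      case (inj₂ w∈sg)    = let _ , _ , _ , at-k = sg⊆ w w∈sg in off (Xw , []=⇒∈ at-k)

  bypass-to-next : ps [ β ]= v → β < m → Bypass β (suc β)
  bypass-to-next {v = v} at-β β<m with w , at-next ← <length⇒[]= ps (≤-<-trans β<m ([]=⇒<length u-at-m)) =
    w , at-next , v , v ∷ w ∷ [] , at-β ,
    (step Sv (walk-arc Wp at-β at-next) (stop Sw) , (v≢w ∷ []) ∷ [] ∷ []) , clean
    where
    Sv = walk-⊆ Wp ([]=⇒∈ at-β)
    Sw = walk-⊆ Wp ([]=⇒∈ at-next)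
    v≢w : v ≢ w
    v≢w refl = <-irrefl (position-unique at-β at-next) (n<1+n _)
    clean : Clean v w (v ∷ w ∷ [])
    clean _ (here e)         = inj₁ e
    clean _ (there (here e)) = inj₂ (inj₁ e)

  X-position>0 : ps [ i ]= v → X v → 0 < i
  X-position>0 {i = zero}  at-0 Xv = ⊥-elim (r∉X (subst X ([]=-functional at-0 r-at-0) Xv))
  X-position>0 {i = suc _} _    _  = s≤s z≤n

  front∉X : (L : Linkage α β) → β < m → (∀ b → ¬ Overreach α β b) → ¬ X (front L)
  front∉X {α = α} L β<m no-overreach X-front = avoidable _ X-front λ avoiding →
    refute (straddle (front-at L) β<m (X-position>0 (front-at L) X-front) avoiding)
    where
    refute : Straddles _ → ⊥
    refute (a , b , a<β , β<b , bp) with a <? α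
    ... | yes a<α = <⇒≱ β<b (early L a a<α b bp)
    ... | no a≮α  = no-overreach b (a , ≮⇒≥ a≮α , a<β , bp , β<b)

  linkage-step : Linkage α β → β < m → ¬ ¬ ∃ λ b → β < b × Linkage β b
  linkage-step {α = α} {β = β} L β<m = do
    inj₁ no-overreach ← ¬¬-maximum (Overreach α β) m (λ { _ (_ , _ , _ , bp , _) → bypass-≤m bp })
      where inj₂ (b , ov@(_ , _ , _ , _ , β<b) , maximal) → return (b , β<b , advance-overreach L ov maximal)
    inj₂ (b , bp , upTo) ← ¬¬-maximum (Bypass β) m (λ _ → bypass-≤m)
      where inj₁ no-bypass → ⊥-elim (no-bypass _ next)
    return (b , upTo _ next , advance-front L (front∉X L β<m no-overreach) no-overreach bp upTo (upTo _ next))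
    where
    next = bypass-to-next (front-at L) β<m

  linkage-extend : ∀ k → Linkage α β → m ≤ β + k → ¬ ¬ TwoWalks
  linkage-extend {β = β} k L m≤β+k with β <? m | k
  ... | no β≮m  | _     =
    return (linkage-complete (subst (Linkage _) (≤-antisym (≤m (front-at L)) (≮⇒≥ β≮m)) L))
  ... | yes β<m | zero  = ⊥-elim (<⇒≱ β<m (subst (m ≤_) (+-identityʳ β) m≤β+k))
  ... | yes β<m | suc k = do
    b , β<b , L′ ← linkage-step L β<m
    linkage-extend k L′ (≤-trans m≤β+k (subst (_≤ b + k) (sym (+-suc β k)) (+-monoˡ-≤ k β<b)))

  X-disjoint-walks : ¬ ¬ TwoWalks
  X-disjoint-walks = linkage-extend m linkage-start ≤-refl

  X-disjoint-paths : ¬ ¬ ∃₂ λ as bs → IsPath H S r u as × IsPath H S r u bs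
                                      × (∀ w → X w → w ∈ₗ as → w ∈ₗ bs → ⊥)
  X-disjoint-paths = do
    _ , _ , Wa , Wb , disjoint ← X-disjoint-walks
    let as , Pa , as⊆ = walk⇒path Wa
        bs , Pb , bs⊆ = walk⇒path Wb
    return (as , bs , Pa , Pb , λ w Xw w∈as w∈bs → disjoint w Xw (as⊆ w w∈as) (bs⊆ w w∈bs))

-- Separators lie on the cut-decomposition tree

module FirstSeparator {n : ℕ} (H : Digraph n) {S : VSet n} {s u d₁ : Fin n} (pre post : List (Fin n))
  (WP : Walk H S s u (pre ++ d₁ ∷ post)) (UP : Unique (pre ++ d₁ ∷ post))
  (sep₁ : Walks.Separates H S s u d₁) (first : All (λ y → ¬ Walks.Separates H S s u y) pre) where

  open Walks H

  private
    variable
      v w : Fin n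
      vs : List (Fin n)

  W₁ : Walk H S s d₁ (pre ++ [ d₁ ])
  W₁ = proj₁ (walk-split pre post WP)

  W₂ : Walk H S d₁ u (d₁ ∷ post)
  W₂ = proj₂ (walk-split pre post WP)

  avoid-both : Walk H S s w vs → d₁ ∉ₗ vs → ∀ {ws} → Walk H S w u ws → d₁ ∉ₗ ws → ⊥
  avoid-both {vs = vs} W d₁∉ {ws} W′ d₁∉′ =
    Sum.[ d₁∉ , d₁∉′ ] (∈-++ʷ⁻ vs ws (separates-walk sep₁ (W ++ʷ W′)))

  avoid⇒¬Diblock : Walk H S w u vs → d₁ ∉ₗ vs → ¬ Diblock H S s w
  avoid⇒¬Diblock W d₁∉ (_ , inj₁ refl) =
    avoid-both (stop (source∈S W)) (λ { (here refl) → proj₁ sep₁ refl }) W d₁∉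
  avoid⇒¬Diblock W d₁∉ (Sw , inj₂ (inj₁ arc)) =
    avoid-both (step (source∈S WP) arc (stop Sw))
      (λ { (here e) → proj₁ sep₁ e ; (there (here refl)) → d₁∉ (source∈walk W) }) W d₁∉
  avoid⇒¬Diblock W d₁∉ (_ , inj₂ (inj₂ (p₁ , p₂ , (W₁′ , _) , (W₂′ , _) , internally-disjoint)))
    with d₁ ∈ₗ? p₁ | d₁ ∈ₗ? p₂
  ... | no d₁∉p₁   | _          = avoid-both W₁′ d₁∉p₁ W d₁∉
  ... | yes _      | no d₁∉p₂   = avoid-both W₂′ d₁∉p₂ W d₁∉
  ... | yes d₁∈p₁  | yes d₁∈p₂  with internally-disjoint d₁ d₁∈p₁ d₁∈p₂
  ...   | inj₁ d₁≡s  = proj₁ sep₁ d₁≡s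
  ...   | inj₂ refl  = d₁∉ (source∈walk W)

  avoid⇒X : S v → Walk H S v u vs → d₁ ∉ₗ vs → XSet H S s d₁ v
  avoid⇒X {vs = vs} Sv W d₁∉ = Sv , avoid⇒¬Diblock W d₁∉ , last-in
    where
    last-in : ∀ qs → IsPath H S s _ qs → LastIn H (Diblock H S s) d₁ qs
    last-in qs (Wq , uq) with d₁ ∈ₗ? qs
    ... | no d₁∉qs = ⊥-elim (avoid-both Wq d₁∉qs W d₁∉)
    ... | yes d₁∈qs with pre′ , post′ , refl ← ∈-∃++ d₁∈qs = pre′ , post′ , refl , All.tabulate ¬diblock
      where
      ¬diblock : y ∈ₗ post′ → ¬ Diblock H S s y
      ¬diblock y∈ with ws , Wy , d₁∉ws ← suffix-avoids pre′ Wq uq y∈ =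
        avoid⇒¬Diblock (Wy ++ʷ W) λ d₁∈ → Sum.[ d₁∉ws , d₁∉ ] (∈-++ʷ⁻ ws vs d₁∈)

  Interior : Fin n → Set
  Interior y = S y × y ≢ s × y ≢ d₁

  -- A vertex separating s from d₁ would lie on pre and separate s from u, against the choice of d₁.
  interior-non-separating : ∀ y → Interior y → ¬ Separates S s d₁ y
  interior-non-separating y (_ , y≢s , y≢d₁) sep = All.lookup first y∈pre (y≢s , on-s-u-paths)
    where
    drop-d₁ : ∀ pre′ → y ∈ₗ pre′ ++ [ d₁ ] → y ∈ₗ pre′
    drop-d₁ pre′ y∈ = Sum.[ (λ y∈pre′ → y∈pre′) , (λ { (here y≡d₁) → ⊥-elim (y≢d₁ y≡d₁) }) ]
                                (∈-++⁻ pre′ y∈)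
    y∈pre : y ∈ₗ pre
    y∈pre = drop-d₁ pre (separates-walk sep W₁)
    on-s-u-paths : ∀ qs → IsPath H S s u qs → y ∈ₗ qs
    on-s-u-paths qs (Wq , uq) with p₁ , p₂ , refl ← ∈-∃++ (proj₂ sep₁ qs (Wq , uq)) =
      ∈-++⁺ˡ (drop-d₁ p₁ (proj₂ sep _ (proj₁ (walk-split p₁ p₂ Wq) , Unique-++∷⇒Unique-++[] p₁ uq)))

  d₁∈diblock : ¬ ¬ Diblock H S s d₁
  d₁∈diblock = do
    p₁ , p₂ , P₁ , P₂ , disjoint ←
      TwoPaths.X-disjoint-paths H S Interior W₁ (Unique-++∷⇒Unique-++[] pre UP)
        (λ (_ , s≢s , _) → s≢s refl) (λ (_ , _ , d₁≢d₁) → d₁≢d₁ refl) interior-non-separating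
    return (target∈S W₁ , inj₂ (inj₂ (p₁ , p₂ , P₁ , P₂ , internally-disjoint p₁ P₁ disjoint)))
    where
    internally-disjoint : ∀ p₁ {p₂} → IsPath H S s d₁ p₁ → (∀ w → Interior w → w ∈ₗ p₁ → w ∈ₗ p₂ → ⊥)
                        → ∀ w → w ∈ₗ p₁ → w ∈ₗ p₂ → w ≡ s ⊎ w ≡ d₁
    internally-disjoint p₁ (W , _) disjoint w w∈₁ w∈₂ with w ≟ᶠ s | w ≟ᶠ d₁
    ... | yes w≡s | _        = inj₁ w≡s
    ... | no _    | yes w≡d₁ = inj₂ w≡d₁
    ... | no w≢s  | no w≢d₁  = ⊥-elim (disjoint w (walk-⊆ W w∈₁ , w≢s , w≢d₁) w∈₁ w∈₂)

  d₁-bottleneck : d₁ ≢ u → ¬ ¬ Bottleneck H S s d₁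
  d₁-bottleneck d₁≢u = do
    d₁∈B ← d₁∈diblock
    return (d₁∈B , proj₁ sep₁ , u , avoid⇒X Su (stop Su) λ { (here d₁≡u) → d₁≢u d₁≡u })
    where
    Su = target∈S WP

  S₁ : VSet n
  S₁ = SubSet H S s d₁

  S₁⊆S : S₁ v → S v
  S₁⊆S (inj₁ (Sv , _)) = Sv
  S₁⊆S (inj₂ refl)     = target∈S W₁

  suffix-walk : Walk H S₁ d₁ u (d₁ ∷ post)
  suffix-walk = walk-restrict W₂ in-S₁
    where
    in-S₁ : ∀ y → y ∈ₗ d₁ ∷ post → S₁ y
    in-S₁ y (here refl) = inj₂ refl
    in-S₁ y (there y∈) = let _ , Wy , d₁∉ = suffix-avoids pre WP UP y∈ in inj₁ (avoid⇒X (source∈S Wy) Wy d₁∉)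

  separator-position : Separates S s u y → y ≡ d₁ ⊎ y ∈ₗ post
  separator-position sep with ∈-++⁻ pre (proj₂ sep _ (WP , UP))
  ... | inj₁ y∈pre        = ⊥-elim (All.lookup first y∈pre sep)
  ... | inj₂ (here y≡d₁)  = inj₁ y≡d₁
  ... | inj₂ (there y∈)   = inj₂ y∈

  later-separator : y ∈ₗ post → Separates S s u y → Separates S₁ d₁ u y
  later-separator {y} y∈post sep = y≢d₁ , on-paths
    where
    y≢d₁ : y ≢ d₁
    y≢d₁ refl = Unique[x∷xs]⇒x∉xs (Unique-++⁻ʳ pre UP) y∈post
    on-paths : ∀ qs → IsPath H S₁ d₁ u qs → y ∈ₗ qs
    on-paths qs (Wq , _)
      with ∈-++ʷ⁻ (pre ++ [ d₁ ]) qs (separates-walk sep (W₁ ++ʷ walk-restrict Wq (λ _ → S₁⊆S ∘ walk-⊆ Wq)))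
    ... | inj₂ y∈qs = y∈qs
    ... | inj₁ y∈   with ∈-++⁻ pre y∈
    ...   | inj₁ y∈pre       = ⊥-elim (All.lookup first y∈pre sep)
    ...   | inj₂ (here y≡d₁) = ⊥-elim (y≢d₁ y≡d₁)

  d₁≢target : Separates S s u y → y ≢ u → d₁ ≢ u
  d₁≢target sep y≢u d₁≡u with separator-position sep
  ... | inj₁ refl    = y≢u d₁≡u
  ... | inj₂ y∈post =
    Unique[x∷xs]⇒x∉xs (Unique-++⁻ʳ pre UP) (subst (_∈ₗ post) (sym d₁≡u) (target∈tail W₂ y∈post))

module _ {n : ℕ} (H : Digraph n) where

  open Walks H

  separator⇒TreeNode : ∀ k {S s u d ps} → IsPath H S s u ps → length ps ≤ k
                     → Separates S s u d → d ≢ u → ¬ ¬ TreeNode H S s d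
  separator⇒TreeNode zero    {ps = []} (() , _)
  separator⇒TreeNode (suc k) {S} {s} {u} {d} {ps} P ps≤k sep d≢u = do
    pre , _ , post , ps≡ , sep₁ , first ← ¬¬-first (Separates S s u) ps (proj₂ sep ps P) sep
    descend pre post (subst (IsPath H S s u) ps≡ P) sep₁ first (subst (λ qs → length qs ≤ suc k) ps≡ ps≤k)
    where
    descend : ∀ pre {d₁} post → IsPath H S s u (pre ++ d₁ ∷ post) → Separates S s u d₁
            → All (λ y → ¬ Separates S s u y) pre → length (pre ++ d₁ ∷ post) ≤ suc k → ¬ ¬ TreeNode H S s d
    descend pre post (WP , UP) sep₁ first len = do
      B ← d₁-bottleneck (d₁≢target sep d≢u)
      Sum.[ (λ { refl → return (below B root) }) , deeper B ] (separator-position sep)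
      where
      open FirstSeparator H pre post WP UP sep₁ first
      deeper : Bottleneck H S s _ → d ∈ₗ post → ¬ ¬ TreeNode H S s d
      deeper B d∈post = do
        t ← separator⇒TreeNode k (suffix-walk , Unique-++⁻ʳ pre UP)
              (≤-pred (<-≤-trans (suffix-shorter pre WP (proj₁ sep₁)) len)) (later-separator d∈post sep) d≢u
        return (below B t)

-- Counting and decidability

∣p∩x∣+∣q∩x∣≤∣x∣ : ∀ {k} (p q x : Subset k) → (∀ i → i ∈ p → i ∈ q → i ∈ x → ⊥)
                → ∣ p ∩ x ∣ + ∣ q ∩ x ∣ ≤ ∣ x ∣
∣p∩x∣+∣q∩x∣≤∣x∣ []      []      []      _        = z≤n
∣p∩x∣+∣q∩x∣≤∣x∣ (s ∷ p) (t ∷ q) (c ∷ x) disjoint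
  with ih ← ∣p∩x∣+∣q∩x∣≤∣x∣ p q x
              (λ i i∈p i∈q i∈x → disjoint (suc i) (Vec.there i∈p) (Vec.there i∈q) (Vec.there i∈x))
  with s | t | c
... | outside | outside | outside = ih
... | outside | inside  | outside = ih
... | inside  | outside | outside = ih
... | inside  | inside  | outside = ih
... | outside | outside | inside  = m≤n⇒m≤1+n ih
... | inside  | outside | inside  = s≤s ih
... | outside | inside  | inside  = subst (_≤ suc ∣ x ∣) (sym (+-suc ∣ p ∩ x ∣ ∣ q ∩ x ∣)) (s≤s ih)
... | inside  | inside  | inside  = ⊥-elim (disjoint zero Vec.here Vec.here Vec.here)

∈vertexSet⇒∈ : ∀ {n} {w : Fin n} ps → w ∈ vertexSet ps → w ∈ₗ ps
∈vertexSet⇒∈ []       w∈ = ⊥-elim (∉⊥ w∈)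
∈vertexSet⇒∈ (v ∷ ps) w∈ with x∈p∪q⁻ ⁅ v ⁆ (vertexSet ps) w∈
... | inj₁ w∈⁅v⁆ = here (x∈⁅y⁆⇒x≡y v w∈⁅v⁆)
... | inj₂ w∈ps  = there (∈vertexSet⇒∈ ps w∈ps)

∣⁅x⁆∪p∣≡1+∣p∣ : ∀ {n} (x : Fin n) (p : Subset n) → ¬ (x ∈ p) → ∣ ⁅ x ⁆ ∪ p ∣ ≡ suc ∣ p ∣
∣⁅x⁆∪p∣≡1+∣p∣ zero    (inside  ∷ p) x∉p = ⊥-elim (x∉p Vec.here)
∣⁅x⁆∪p∣≡1+∣p∣ zero    (outside ∷ p) _   = cong (suc ∘ ∣_∣) (∪-identityˡ p)
∣⁅x⁆∪p∣≡1+∣p∣ (suc x) (inside  ∷ p) x∉p = cong suc (∣⁅x⁆∪p∣≡1+∣p∣ x p (x∉p ∘ Vec.there))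
∣⁅x⁆∪p∣≡1+∣p∣ (suc x) (outside ∷ p) x∉p = ∣⁅x⁆∪p∣≡1+∣p∣ x p (x∉p ∘ Vec.there)

∣vertexSet∣≡length : ∀ {n} (ps : List (Fin n)) → Unique ps → ∣ vertexSet ps ∣ ≡ length ps
∣vertexSet∣≡length {n} [] _ = ∣⊥∣≡0 n
∣vertexSet∣≡length (v ∷ ps) (v∉ ∷ u) =
  trans (∣⁅x⁆∪p∣≡1+∣p∣ v (vertexSet ps) (Unique[x∷xs]⇒x∉xs (v∉ ∷ u) ∘ ∈vertexSet⇒∈ ps))
        (cong suc (∣vertexSet∣≡length ps u))

Unique⇒length≤n : ∀ {n} (ps : List (Fin n)) → Unique ps → length ps ≤ n
Unique⇒length≤n ps u = subst (_≤ _) (∣vertexSet∣≡length ps u) (∣p∣≤n (vertexSet ps))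

bounded-list? : ∀ {n} k (P : List (Fin n) → Set) → (∀ xs → Dec (P xs))
              → Dec (∃ λ xs → length xs ≤ k × P xs)
bounded-list? zero P P? with P? []
... | yes p[] = yes ([] , z≤n , p[])
... | no ¬p[] = no λ { ([] , _ , p[]) → ¬p[] p[] }
bounded-list? (suc k) P P? with P? [] | any? (λ x → bounded-list? k (P ∘ (x ∷_)) (P? ∘ (x ∷_)))
... | yes p[] | _                           = yes ([] , z≤n , p[])
... | no _    | yes (x , xs , xs≤k , pxxs)  = yes (x ∷ xs , s≤s xs≤k , pxxs)
... | no ¬p[] | no ¬px                      =
  no λ { ([] , _ , p[]) → ¬p[] p[] ; (x ∷ xs , s≤s xs≤k , pxxs) → ¬px (x , xs , xs≤k , pxxs) }

module _ {n : ℕ} (H : Digraph n) where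

  open Walks H
  open import Data.List.Relation.Unary.Unique.DecPropositional (_≟ᶠ_ {n}) using (unique?)

  walk? : ∀ s t vs → Dec (Walk H Full s t vs)
  walk? s t []                 = no λ ()
  walk? s t (x ∷ [])           with x ≟ᶠ s | x ≟ᶠ t
  ... | yes refl | yes refl = yes (stop tt)
  ... | no x≢s   | _        = no λ { (stop _) → x≢s refl ; (step _ _ ()) }
  ... | yes refl | no x≢t   = no λ { (stop _) → x≢t refl ; (step _ _ ()) }
  walk? s t (x ∷ y ∷ vs)       with x ≟ᶠ s | H x y Bool.≟ true | walk? y t (y ∷ vs)
  ... | yes refl | yes arc | yes W  = yes (step tt arc W)
  ... | no x≢s   | _       | _      = no λ W → x≢s (∷-injectiveˡ (walk-head W))
  ... | yes refl | no ¬arc | _      = no (¬arc ∘ proj₁ ∘ step⁻)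
  ... | yes refl | yes _   | no ¬W  = no (¬W ∘ proj₂ ∘ step⁻)

  path? : ∀ s t (P : List (Fin n) → Set) → (∀ ps → Dec (P ps))
        → Dec (∃ λ ps → IsPath H Full s t ps × P ps)
  path? s t P P? with bounded-list? n (λ ps → IsPath H Full s t ps × P ps)
                                     (λ ps → (walk? s t ps ×-dec unique? ps) ×-dec P? ps)
  ... | yes (ps , _ , good) = yes (ps , good)
  ... | no ¬good            = no λ (ps , good@((_ , u) , _)) → ¬good (ps , Unique⇒length≤n ps u , good)

2*min≤ : ∀ a b {c} → a + b ≤ c → 2 * a ≤ c ⊎ 2 * b ≤ c
2*min≤ a b {c} a+b≤c with ≤-total a b
... | inj₁ a≤b = inj₁ (≤-trans (+-monoʳ-≤ a (subst (_≤ b) (sym (+-identityʳ a)) a≤b)) a+b≤c)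
... | inj₂ b≤a =
  inj₂ (≤-trans (+-monoʳ-≤ b (subst (_≤ a) (sym (+-identityʳ b)) b≤a)) (subst (_≤ c) (+-comm a b) a+b≤c))

X-disjoint⇒half : ∀ {n} (X : Subset n) as bs → (∀ w → w ∈ X → w ∈ₗ as → w ∈ₗ bs → ⊥)
                → 2 * ∣ vertexSet as ∩ X ∣ ≤ ∣ X ∣ ⊎ 2 * ∣ vertexSet bs ∩ X ∣ ≤ ∣ X ∣
X-disjoint⇒half X as bs disjoint =
  2*min≤ ∣ vertexSet as ∩ X ∣ ∣ vertexSet bs ∩ X ∣ (∣p∩x∣+∣q∩x∣≤∣x∣ (vertexSet as) (vertexSet bs) X
    λ w w∈as w∈bs w∈X → disjoint w w∈X (∈vertexSet⇒∈ as w∈as) (∈vertexSet⇒∈ bs w∈bs))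

corollary2 : ∀ {n} (H : Digraph n) (r : Fin n)
    → (∀ v → Reachable H Full r v)
    → ∀ (u : Fin n) (X : Subset n)
    → (∀ v → v ∈ X → ¬ TreeNode H Full r v × v ≢ u)
    → ∃ λ ps → IsPath H Full r u ps × 2 * ∣ vertexSet ps ∩ X ∣ ≤ ∣ X ∣
corollary2 H r reach u X outside-tree =
  decidable-stable (path? H r u _ λ ps → 2 * ∣ vertexSet ps ∩ X ∣ ≤? ∣ X ∣) do
    as , bs , Pa , Pb , disjoint ← TwoPaths.X-disjoint-paths H Full (_∈ X) Wp up r∉X u∉X non-separating
    return (Sum.[ (λ as-good → as , Pa , as-good) , (λ bs-good → bs , Pb , bs-good) ]
              (X-disjoint⇒half X as bs disjoint))
  where
  open Walks H
  ps = proj₁ (reach u)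
  Wp = proj₁ (proj₂ (reach u))
  up = proj₂ (proj₂ (reach u))

  r∉X : ¬ r ∈ X
  r∉X r∈X = proj₁ (outside-tree r r∈X) root

  u∉X : ¬ u ∈ X
  u∉X u∈X = proj₂ (outside-tree u u∈X) refl

  non-separating : ∀ x → x ∈ X → ¬ Separates Full r u x
  non-separating x x∈X sep = let x∉T , x≢u = outside-tree x x∈X in
    separator⇒TreeNode H (length ps) (Wp , up) ≤-refl sep x≢u x∉T
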